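{- Let $G$ be an $(n-3)$-regular graph of order $n\ge 6$ and let $B$ be a Roman bondage set of $G$. Suppose $x,y,z$ are three pairwise non-adjacent vertices of $G$ such that each of them is incident with exactly one edge of $B$ (i.e. $|E_G(v)\cap B|=1$ for $v\in\{x,y,z\}$). Then $|B|\ge n-2$; moreover, if $G$ is the complete multipartite graph $K_{3,3,\ldots,3}$ (all parts of size $3$), then $|B|\ge n-1$.
   Context: All graphs are finite, simple and undirected. For a vertex $x$, $E_G(x)$ denotes the set of edges of $G$ incident with $x$. A Roman dominating function on $G=(V,E)$ is a function $f:V\to\{0,1,2\}$ such that every vertex $u$ with $f(u)=0$ is adjacent to some vertex $v$ with $f(v)=2$; its weight is $\sum_{u\in V}f(u)$, and $\gamma_{\rm R}(G)$ is the minimum weight of a Roman dominating function on $G$. A Roman bondage set of $G$ is a set $B\subseteq E(G)$ with $\gamma_{\rm R}(G-B)>\gamma_{\rm R}(G)$. -}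

module Defs where

open import Data.Nat using (ℕ; zero; suc; _+_; _<_; _≤_)
open import Data.Fin using (Fin; toℕ; _<?_) renaming (zero to fzero; suc to fsuc)
open import Data.Bool using (Bool; true; false; _∧_; not; if_then_else_)
open import Data.Product using (Σ; ∃; _×_; _,_)
open import Relation.Binary.PropositionalEquality using (_≡_; _≢_)
open import Relation.Nullary.Decidable using (⌊_⌋)

-- A (simple, undirected) graph on vertex set Fin n, given by a Boolean
-- adjacency relation.  Edge sets are symmetric Boolean relations as well.
Rel₂ : ℕ → Set
Rel₂ n = Fin n → Fin n → Bool

record IsSimpleGraph {n : ℕ} (adj : Rel₂ n) : Set where
  field
    irrefl : ∀ i → adj i i ≡ false
    sym    : ∀ i j → adj i j ≡ adj j i

count : ∀ {n} → (Fin n → Bool) → ℕ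
count {zero}  p = 0
count {suc n} p = (if p fzero then 1 else 0) + count (λ i → p (fsuc i))

sumF : ∀ {n} → (Fin n → ℕ) → ℕ
sumF {zero}  f = 0
sumF {suc n} f = f fzero + sumF (λ i → f (fsuc i))

deg : ∀ {n} → Rel₂ n → Fin n → ℕ
deg adj v = count (adj v)

Regular : ∀ {n} → Rel₂ n → ℕ → Set
Regular adj r = ∀ v → deg adj v ≡ r

edgeCount : ∀ {n} → Rel₂ n → ℕ
edgeCount B = sumF (λ i → count (λ j → ⌊ i <? j ⌋ ∧ B i j))

IsEdgeSubset : ∀ {n} → Rel₂ n → Rel₂ n → Set
IsEdgeSubset adj B = (∀ i j → B i j ≡ B j i) × (∀ i j → B i j ≡ true → adj i j ≡ true)

removeEdges : ∀ {n} → Rel₂ n → Rel₂ n → Rel₂ n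
removeEdges adj B i j = adj i j ∧ not (B i j)

weight : ∀ {n} → (Fin n → Fin 3) → ℕ
weight f = sumF (λ i → toℕ (f i))

IsRDF : ∀ {n} → Rel₂ n → (Fin n → Fin 3) → Set
IsRDF adj f = ∀ u → toℕ (f u) ≡ 0 → ∃ λ v → adj u v ≡ true × toℕ (f v) ≡ 2

IsRomanDomNumber : ∀ {n} → Rel₂ n → ℕ → Set
IsRomanDomNumber adj k =
  (∃ λ f → IsRDF adj f × weight f ≡ k) × (∀ f → IsRDF adj f → k ≤ weight f)

-- B is a Roman bondage set: γ_R(G - B) > γ_R(G)
-- (equivalently: every RDF of G - B has weight > γ_R(G))
IsRomanBondageSet : ∀ {n} → Rel₂ n → Rel₂ n → Set
IsRomanBondageSet adj B =
  IsEdgeSubset adj B ×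
  ∃ λ k → IsRomanDomNumber adj k ×
          (∀ f → IsRDF (removeEdges adj B) f → k < weight f)

-- |E_G(v) ∩ B| (B ⊆ E(G))
edgesAtIn : ∀ {n} → Rel₂ n → Fin n → ℕ
edgesAtIn B v = count (B v)

IsK333 : ∀ {n} → Rel₂ n → Set
IsK333 {n} adj =
  Σ ℕ λ m → Σ (Fin n → Fin m) λ part →
    (∀ (c : Fin m) → count (λ v → ⌊ part v Data.Fin.≟ c ⌋) ≡ 3) ×
    (∀ i j → (adj i j ≡ true → part i ≢ part j) × (part i ≢ part j → adj i j ≡ true))

module Submission where

-- In an (n − 3)-regular graph every vertex has exactly two non-neighbours, so a vertex
-- valued 2 dominates all but two vertices and γ_R(G) ≥ 4.  As B is a bondage set, G − B has
-- no Roman dominating function of weight 4: neither 2, 2 on a dominating pair nor 2, 1, 1 on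
-- a vertex and its two non-neighbours.  Since x, y, z are mutual non-neighbours, every other
-- vertex is adjacent to all three.  Excluding the first kind shows that x, y, z share their
-- unique B-neighbour w and that every edge at w lies in B, so deg_B w = n − 3; excluding the
-- second kind shows that every vertex meets B.  The B-degrees over an independent set sum to
-- at most |B|, which for w and a non-neighbour of w gives |B| ≥ (n − 3) + 1, and for the
-- whole part {w, a, b} of w in K_{3,…,3} gives |B| ≥ (n − 3) + 2.

open import Defs
open import Data.Nat using (ℕ; zero; suc; _+_; _*_; _≤_; _<_; _∸_; z≤n; s≤s)
open import Data.Nat.Properties
  using (+-*-semiring; +-identityʳ; *-identityʳ; +-comm; +-assoc; +-mono-≤; +-monoʳ-≤; m≤m+n;
         ≤-refl; ≤-reflexive; ≤-trans; ≤-<-trans; <-irrefl; module ≤-Reasoning;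
         suc-injective; +-cancelˡ-≡; m∸n+n≡m; *-cancelˡ-≤)
  renaming (_≟_ to _≟ℕ_)
open import Algebra.Properties.Semiring.Sum +-*-semiring
  using (sum; sum-syntax; sum-cong-≗; ∑-distrib-+; ∑-comm; *-distribʳ-sum; sum-replicate-zero)
open import Data.Fin using (Fin; zero; suc; toℕ; _≟_; _<?_)
open import Data.Fin.Patterns using (0F; 1F; 2F)
open import Data.Fin.Properties using (<-asym; <-cmp; any?)
open import Data.Bool using (Bool; true; false; _∧_; _∨_; not; if_then_else_)
open import Data.Bool.Properties using (not-injective)
open import Data.Product using (∃; _×_; _,_; proj₁; proj₂)
open import Data.Sum using (_⊎_; inj₁; inj₂; [_,_]′)
open import Function using (_∘_; id)
open import Relation.Binary.Definitions using (tri<; tri≈; tri>)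
open import Relation.Binary.PropositionalEquality
open import Relation.Nullary using (¬_; yes; no; does; contradiction)
open import Relation.Nullary.Decidable using (⌊_⌋; dec-true; dec-false)

𝟙 : Bool → ℕ
𝟙 b = if b then 1 else 0

sumF≡sum : ∀ {n} (f : Fin n → ℕ) → sumF f ≡ sum f
sumF≡sum {zero}  f = refl
sumF≡sum {suc n} f = cong (f zero +_) (sumF≡sum (f ∘ suc))

count≡∑𝟙 : ∀ {n} (p : Fin n → Bool) → count p ≡ ∑[ i < n ] 𝟙 (p i)
count≡∑𝟙 {zero}  p = refl
count≡∑𝟙 {suc n} p = cong (𝟙 (p zero) +_) (count≡∑𝟙 (p ∘ suc))

sum-mono-≤ : ∀ {n} {f g : Fin n → ℕ} → (∀ i → f i ≤ g i) → sum f ≤ sum g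
sum-mono-≤ {zero}  f≤g = z≤n
sum-mono-≤ {suc n} f≤g = +-mono-≤ (f≤g zero) (sum-mono-≤ (f≤g ∘ suc))

sum-ones : ∀ n → ∑[ i < n ] 1 ≡ n
sum-ones zero    = refl
sum-ones (suc n) = cong suc (sum-ones n)

point : ∀ {n} → Fin n → ℕ → Fin n → ℕ
point a k i = if does (i ≟ a) then k else 0

sum-point : ∀ {n} (a : Fin n) k → sum (point a k) ≡ k
sum-point {suc n} zero    k = trans (cong (k +_) (sum-replicate-zero n)) (+-identityʳ k)
sum-point {suc n} (suc a) k = sum-point a k

_∖ᶠ_ : ∀ {n} → (Fin n → ℕ) → Fin n → Fin n → ℕ
(f ∖ᶠ a) i = if does (i ≟ a) then 0 else f i

∖ᶠ-≢ : ∀ {n} (f : Fin n → ℕ) {a i} → i ≢ a → (f ∖ᶠ a) i ≡ f i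
∖ᶠ-≢ f {a} {i} i≢a rewrite dec-false (i ≟ a) i≢a = refl

sum-extract : ∀ {n} (f : Fin n → ℕ) a → sum f ≡ f a + sum (f ∖ᶠ a)
sum-extract {n} f a = begin
  sum f                                       ≡⟨ sum-cong-≗ split ⟩
  ∑[ i < n ] (point a (f a) i + (f ∖ᶠ a) i)   ≡⟨ ∑-distrib-+ (point a (f a)) (f ∖ᶠ a) ⟩
  sum (point a (f a)) + sum (f ∖ᶠ a)          ≡⟨ cong (_+ sum (f ∖ᶠ a)) (sum-point a (f a)) ⟩
  f a + sum (f ∖ᶠ a)                          ∎
  where
  open ≡-Reasoning
  split : ∀ i → f i ≡ point a (f a) i + (f ∖ᶠ a) i
  split i with i ≟ a
  ... | yes refl = sym (+-identityʳ (f i))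
  ... | no _     = refl

≤-sum : ∀ {n} (f : Fin n → ℕ) a → f a ≤ sum f
≤-sum f a = ≤-trans (m≤m+n (f a) _) (≤-reflexive (sym (sum-extract f a)))

pair≤sum : ∀ {n} (f : Fin n → ℕ) {a b} → b ≢ a → f a + f b ≤ sum f
pair≤sum f {a} {b} b≢a = begin
  f a + f b              ≡⟨ cong (f a +_) (sym (∖ᶠ-≢ f b≢a)) ⟩
  f a + (f ∖ᶠ a) b       ≤⟨ +-monoʳ-≤ (f a) (≤-sum (f ∖ᶠ a) b) ⟩
  f a + sum (f ∖ᶠ a)     ≡⟨ sum-extract f a ⟨
  sum f                  ∎
  where open ≤-Reasoning

triple≤sum : ∀ {n} (f : Fin n → ℕ) {a b c} → b ≢ a → c ≢ a → c ≢ b → f a + f b + f c ≤ sum f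
triple≤sum f {a} {b} {c} b≢a c≢a c≢b = begin
  f a + f b + f c                  ≡⟨ +-assoc (f a) (f b) (f c) ⟩
  f a + (f b + f c)                ≡⟨ cong (f a +_) (sym (cong₂ _+_ (∖ᶠ-≢ f b≢a) (∖ᶠ-≢ f c≢a))) ⟩
  f a + ((f ∖ᶠ a) b + (f ∖ᶠ a) c)  ≤⟨ +-monoʳ-≤ (f a) (pair≤sum (f ∖ᶠ a) c≢b) ⟩
  f a + sum (f ∖ᶠ a)               ≡⟨ sum-extract f a ⟨
  sum f                            ∎
  where open ≤-Reasoning

_∖_ : ∀ {n} → (Fin n → Bool) → Fin n → Fin n → Bool
(p ∖ a) i = if does (i ≟ a) then false else p i

∖-≢ : ∀ {n} (p : Fin n → Bool) {a i} → i ≢ a → (p ∖ a) i ≡ p i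
∖-≢ p {a} {i} i≢a rewrite dec-false (i ≟ a) i≢a = refl

∖-true : ∀ {n} (p : Fin n → Bool) {a i} → (p ∖ a) i ≡ true → i ≢ a × p i ≡ true
∖-true p {a} {i} pi with i ≟ a
... | no i≢a = i≢a , pi

count-∖ : ∀ {n} (p : Fin n → Bool) {a} → p a ≡ true → count p ≡ suc (count (p ∖ a))
count-∖ {n} p {a} pa = begin
  count p                          ≡⟨ count≡∑𝟙 p ⟩
  ∑[ i < n ] 𝟙 (p i)               ≡⟨ sum-extract (𝟙 ∘ p) a ⟩
  𝟙 (p a) + sum ((𝟙 ∘ p) ∖ᶠ a)     ≡⟨ cong₂ _+_ (cong 𝟙 pa) (sum-cong-≗ 𝟙-∖) ⟩
  suc (∑[ i < n ] 𝟙 ((p ∖ a) i))   ≡⟨ cong suc (count≡∑𝟙 (p ∖ a)) ⟨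
  suc (count (p ∖ a))              ∎
  where
  open ≡-Reasoning
  𝟙-∖ : ∀ i → ((𝟙 ∘ p) ∖ᶠ a) i ≡ 𝟙 ((p ∖ a) i)
  𝟙-∖ i with does (i ≟ a)
  ... | true  = refl
  ... | false = refl

count≡0⇒false : ∀ {n} {p : Fin n → Bool} → count p ≡ 0 → ∀ i → p i ≡ false
count≡0⇒false {p = p} count≡0 i with p i in pi
... | false = refl
... | true  = contradiction (trans (sym (count-∖ p pi)) count≡0) λ ()

count≡suc⇒∃ : ∀ {n} (p : Fin n → Bool) {k} → count p ≡ suc k → ∃ λ i → p i ≡ true
count≡suc⇒∃ {suc n} p count≡suc with p zero in p0
... | true  = zero , p0
... | false with count≡suc⇒∃ (p ∘ suc) count≡suc
...   | i , pi = suc i , pi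

count≡1-unique : ∀ {n} (p : Fin n → Bool) {a b} → count p ≡ 1 → p a ≡ true → p b ≡ true → b ≡ a
count≡1-unique p {a} {b} count≡1 pa pb with b ≟ a
... | yes b≡a = b≡a
... | no b≢a  = contradiction (trans (sym pb) (trans (sym (∖-≢ p b≢a)) (count≡0⇒false rest≡0 b))) λ ()
  where
  rest≡0 : count (p ∖ a) ≡ 0
  rest≡0 = suc-injective (trans (sym (count-∖ p pa)) count≡1)

count≡1-only : ∀ {n} (p : Fin n → Bool) {a i} → count p ≡ 1 → p a ≡ true → i ≢ a → p i ≡ false
count≡1-only p {i = i} count≡1 pa i≢a with p i in pi
... | false = refl
... | true  = contradiction (count≡1-unique p count≡1 pa pi) i≢a

count-cong : ∀ {n} {p q : Fin n → Bool} → (∀ i → p i ≡ q i) → count p ≡ count q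
count-cong {p = p} {q} p≗q = trans (count≡∑𝟙 p) (trans (sum-cong-≗ (cong 𝟙 ∘ p≗q)) (sym (count≡∑𝟙 q)))

count+count-not : ∀ {n} (p : Fin n → Bool) → count p + count (not ∘ p) ≡ n
count+count-not {n} p = begin
  count p + count (not ∘ p)                     ≡⟨ cong₂ _+_ (count≡∑𝟙 p) (count≡∑𝟙 (not ∘ p)) ⟩
  ∑[ i < n ] 𝟙 (p i) + ∑[ i < n ] 𝟙 (not (p i))  ≡⟨ ∑-distrib-+ (𝟙 ∘ p) (𝟙 ∘ not ∘ p) ⟨
  ∑[ i < n ] (𝟙 (p i) + 𝟙 (not (p i)))          ≡⟨ sum-cong-≗ (λ i → 𝟙+𝟙-not (p i)) ⟩
  ∑[ i < n ] 1                                  ≡⟨ sum-ones n ⟩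
  n                                             ∎
  where
  open ≡-Reasoning
  𝟙+𝟙-not : ∀ b → 𝟙 b + 𝟙 (not b) ≡ 1
  𝟙+𝟙-not true  = refl
  𝟙+𝟙-not false = refl

module _ {n} {B : Rel₂ n} (B-sym : ∀ i j → B i j ≡ B j i) (B-irrefl : ∀ i → B i i ≡ false) where

  degree-sum≡2*edgeCount : ∑[ v < n ] count (B v) ≡ 2 * edgeCount B
  degree-sum≡2*edgeCount = begin
    ∑[ i < n ] count (B i)                                      ≡⟨ sum-cong-≗ (λ i → count≡∑𝟙 (B i)) ⟩
    ∑[ i < n ] ∑[ j < n ] 𝟙 (B i j)                             ≡⟨ sum-cong-≗ (λ i → sum-cong-≗ (split i)) ⟩
    ∑[ i < n ] ∑[ j < n ] (forward i j + backward i j)          ≡⟨ sum-cong-≗ (λ i → ∑-distrib-+ (forward i) (backward i)) ⟩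
    ∑[ i < n ] (∑[ j < n ] forward i j + ∑[ j < n ] backward i j)
      ≡⟨ ∑-distrib-+ (λ i → ∑[ j < n ] forward i j) (λ i → ∑[ j < n ] backward i j) ⟩
    E + ∑[ i < n ] ∑[ j < n ] backward i j                      ≡⟨ cong (E +_) (∑-comm backward) ⟩
    E + ∑[ j < n ] ∑[ i < n ] backward i j                      ≡⟨ cong (E +_) (sum-cong-≗ λ j → sum-cong-≗ λ i →
                                                                     cong (λ b → 𝟙 (⌊ j <? i ⌋ ∧ b)) (B-sym i j)) ⟩
    E + E                                                       ≡⟨ cong (E +_) (+-identityʳ E) ⟨
    2 * E                                                       ≡⟨ cong (2 *_) edges ⟨
    2 * edgeCount B                                             ∎
    where
    open ≡-Reasoning
    forward backward : Fin n → Fin n → ℕ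
    forward  i j = 𝟙 (⌊ i <? j ⌋ ∧ B i j)
    backward i j = 𝟙 (⌊ j <? i ⌋ ∧ B i j)
    E : ℕ
    E = ∑[ i < n ] ∑[ j < n ] forward i j
    edges : edgeCount B ≡ E
    edges = trans (sumF≡sum (λ i → count (λ j → ⌊ i <? j ⌋ ∧ B i j)))
                    (sum-cong-≗ λ i → count≡∑𝟙 (λ j → ⌊ i <? j ⌋ ∧ B i j))
    split : ∀ i j → 𝟙 (B i j) ≡ forward i j + backward i j
    split i j with i <? j | j <? i
    ... | yes i<j | yes j<i = contradiction j<i (<-asym i<j)
    ... | yes _   | no _    = sym (+-identityʳ _)
    ... | no _    | yes _   = refl
    ... | no i≮j  | no j≮i with <-cmp i j
    ...   | tri< i<j _ _    = contradiction i<j i≮j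
    ...   | tri> _ _ j<i    = contradiction j<i j≮i
    ...   | tri≈ _ refl _   = cong 𝟙 (B-irrefl i)

  independent-degree-sum≤edgeCount : (S : Fin n → Bool) → (∀ u v → S u ≡ true → S v ≡ true → B u v ≡ false) →
                                     ∑[ v < n ] (count (B v) * 𝟙 (S v)) ≤ edgeCount B
  -- 2 X counts every edge of B once from each of its ends in S, and it has at most one.
  independent-degree-sum≤edgeCount S independent = *-cancelˡ-≤ 2 (begin
    2 * X                                                         ≡⟨ cong (X +_) (+-identityʳ X) ⟩
    X + X                                                         ≡⟨ cong₂ _+_ rows columns ⟩
    ∑[ v < n ] ∑[ u < n ] fromS v u + ∑[ v < n ] ∑[ u < n ] toS v u
      ≡⟨ ∑-distrib-+ (λ v → ∑[ u < n ] fromS v u) (λ v → ∑[ u < n ] toS v u) ⟨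
    ∑[ v < n ] (∑[ u < n ] fromS v u + ∑[ u < n ] toS v u)          ≡⟨ sum-cong-≗ (λ v → ∑-distrib-+ (fromS v) (toS v)) ⟨
    ∑[ v < n ] ∑[ u < n ] (fromS v u + toS v u)                   ≤⟨ sum-mono-≤ (λ v → sum-mono-≤ (at-most-one-end v)) ⟩
    ∑[ v < n ] ∑[ u < n ] 𝟙 (B v u)                               ≡⟨ sum-cong-≗ (λ v → count≡∑𝟙 (B v)) ⟨
    ∑[ v < n ] count (B v)                                        ≡⟨ degree-sum≡2*edgeCount ⟩
    2 * edgeCount B                                               ∎)
    where
    open ≤-Reasoning
    X : ℕ
    X = ∑[ v < n ] (count (B v) * 𝟙 (S v))
    fromS toS : Fin n → Fin n → ℕ
    fromS v u = 𝟙 (B v u) * 𝟙 (S v)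
    toS   v u = 𝟙 (B v u) * 𝟙 (S u)
    rows : X ≡ ∑[ v < n ] ∑[ u < n ] fromS v u
    rows = sum-cong-≗ λ v → trans (cong (_* 𝟙 (S v)) (count≡∑𝟙 (B v))) (*-distribʳ-sum (𝟙 (S v)) (𝟙 ∘ B v))
    columns : X ≡ ∑[ v < n ] ∑[ u < n ] toS v u
    columns = trans rows (trans (sum-cong-≗ λ u → sum-cong-≗ λ v → cong (λ b → 𝟙 b * 𝟙 (S u)) (B-sym u v))
                                (∑-comm (λ u v → toS v u)))
    at-most-one-end : ∀ v u → fromS v u + toS v u ≤ 𝟙 (B v u)
    at-most-one-end v u with B v u in Bvu | S v in Sv | S u in Su
    ... | false | _     | _     = z≤n
    ... | true  | true  | true  = contradiction (trans (sym Bvu) (independent v u Sv Su)) λ ()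
    ... | true  | true  | false = ≤-refl
    ... | true  | false | true  = ≤-refl
    ... | true  | false | false = z≤n

rdf-positive⊎dominated : ∀ {n} {H : Rel₂ n} {f} → IsRDF H f →
                         ∀ u → 1 ≤ toℕ (f u) ⊎ ∃ λ v → H u v ≡ true × toℕ (f v) ≡ 2
rdf-positive⊎dominated {f = f} isRDF u with f u in fu
... | 0F    = inj₂ (isRDF u (cong toℕ fu))
... | suc _ = inj₁ (s≤s z≤n)

weight≡∑ : ∀ {n} (f : Fin n → Fin 3) → weight f ≡ ∑[ i < n ] toℕ (f i)
weight≡∑ f = sumF≡sum (toℕ ∘ f)

two-twos≤weight : ∀ {n} (f : Fin n → Fin 3) {u v} → u ≢ v → toℕ (f v) ≡ 2 → toℕ (f u) ≡ 2 → 4 ≤ weight f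
two-twos≤weight f u≢v fv≡2 fu≡2 =
  subst₂ _≤_ (cong₂ _+_ fv≡2 fu≡2) (sym (weight≡∑ f)) (pair≤sum (toℕ ∘ f) u≢v)

twoTwo : ∀ {n} → Fin n → Fin n → Fin n → Fin 3
twoTwo p q v = if does (v ≟ p) then 2F else if does (v ≟ q) then 2F else 0F

twoOneOne : ∀ {n} → Fin n → Fin n → Fin n → Fin n → Fin 3
twoOneOne p q r v = if does (v ≟ p) then 2F else if does (v ≟ q) then 1F else if does (v ≟ r) then 1F else 0F

module _ {n} {p q : Fin n} where

  weight-twoTwo : q ≢ p → weight (twoTwo p q) ≡ 4
  weight-twoTwo q≢p = begin
    weight (twoTwo p q)                           ≡⟨ weight≡∑ (twoTwo p q) ⟩
    ∑[ v < n ] toℕ (twoTwo p q v)                 ≡⟨ sum-cong-≗ values ⟩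
    ∑[ v < n ] (point p 2 v + point q 2 v)        ≡⟨ ∑-distrib-+ (point p 2) (point q 2) ⟩
    sum (point p 2) + sum (point q 2)             ≡⟨ cong₂ _+_ (sum-point p 2) (sum-point q 2) ⟩
    4                                             ∎
    where
    open ≡-Reasoning
    values : ∀ v → toℕ (twoTwo p q v) ≡ point p 2 v + point q 2 v
    values v with v ≟ p | v ≟ q
    ... | yes refl | yes refl = contradiction refl q≢p
    ... | yes refl | no _     = refl
    ... | no _     | yes refl = refl
    ... | no _     | no _     = refl

  twoTwo-isRDF : ∀ {H : Rel₂ n} → (∀ u → u ≢ p → u ≢ q → H u p ≡ true ⊎ H u q ≡ true) → IsRDF H (twoTwo p q)
  twoTwo-isRDF dominated u fu≡0 with u ≟ p | u ≟ q
  twoTwo-isRDF dominated u () | yes _    | _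
  twoTwo-isRDF dominated u () | no _     | yes _
  ... | no u≢p | no u≢q = [ (λ Hup → p , Hup , at-p) , (λ Huq → q , Huq , at-q) ]′ (dominated u u≢p u≢q)
    where
    at-p : toℕ (twoTwo p q p) ≡ 2
    at-p rewrite dec-true (p ≟ p) refl = refl
    at-q : toℕ (twoTwo p q q) ≡ 2
    at-q with does (q ≟ p)
    ... | true  = refl
    ... | false rewrite dec-true (q ≟ q) refl = refl

module _ {n} {p q r : Fin n} where

  weight-twoOneOne : q ≢ p → r ≢ p → r ≢ q → weight (twoOneOne p q r) ≡ 4
  weight-twoOneOne q≢p r≢p r≢q = begin
    weight (twoOneOne p q r)                                 ≡⟨ weight≡∑ (twoOneOne p q r) ⟩
    ∑[ v < n ] toℕ (twoOneOne p q r v)                       ≡⟨ sum-cong-≗ values ⟩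
    ∑[ v < n ] (point p 2 v + point q 1 v + point r 1 v)
      ≡⟨ ∑-distrib-+ (λ v → point p 2 v + point q 1 v) (point r 1) ⟩
    ∑[ v < n ] (point p 2 v + point q 1 v) + sum (point r 1)
      ≡⟨ cong (_+ sum (point r 1)) (∑-distrib-+ (point p 2) (point q 1)) ⟩
    sum (point p 2) + sum (point q 1) + sum (point r 1)
      ≡⟨ cong₂ _+_ (cong₂ _+_ (sum-point p 2) (sum-point q 1)) (sum-point r 1) ⟩
    4                                                        ∎
    where
    open ≡-Reasoning
    values : ∀ v → toℕ (twoOneOne p q r v) ≡ point p 2 v + point q 1 v + point r 1 v
    values v with v ≟ p | v ≟ q | v ≟ r
    ... | yes refl | yes refl | _        = contradiction refl q≢p
    ... | yes refl | no _     | yes refl = contradiction refl r≢p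
    ... | no _     | yes refl | yes refl = contradiction refl r≢q
    ... | yes refl | no _     | no _     = refl
    ... | no _     | yes refl | no _     = refl
    ... | no _     | no _     | yes refl = refl
    ... | no _     | no _     | no _     = refl

  twoOneOne-isRDF : ∀ {H : Rel₂ n} → (∀ u → u ≢ p → u ≢ q → u ≢ r → H u p ≡ true) → IsRDF H (twoOneOne p q r)
  twoOneOne-isRDF dominated u fu≡0 with u ≟ p | u ≟ q | u ≟ r
  twoOneOne-isRDF dominated u () | yes _ | _     | _
  twoOneOne-isRDF dominated u () | no _  | yes _ | _
  twoOneOne-isRDF dominated u () | no _  | no _  | yes _
  ... | no u≢p | no u≢q | no u≢r = p , dominated u u≢p u≢q u≢r , at-p
    where
    at-p : toℕ (twoOneOne p q r p) ≡ 2
    at-p rewrite dec-true (p ≟ p) refl = refl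

m∸n≡suc[m∸suc[n]] : ∀ {m n} → n < m → m ∸ n ≡ suc (m ∸ suc n)
m∸n≡suc[m∸suc[n]] {suc m} {zero}  _         = refl
m∸n≡suc[m∸suc[n]] {suc m} {suc n} (s≤s n<m) = m∸n≡suc[m∸suc[n]] n<m

module ComplementTwoRegular {n} {G : Rel₂ n} (simple : IsSimpleGraph G) (6≤n : 6 ≤ n)
                            (regular : Regular G (n ∸ 3)) where

  open IsSimpleGraph simple renaming (irrefl to G-irrefl; sym to G-sym)

  3≤n : 3 ≤ n
  3≤n = ≤-trans (s≤s (s≤s (s≤s z≤n))) 6≤n

  nonAdjacent : Fin n → Fin n → Bool
  nonAdjacent v u = not (G v u)

  count-nonAdjacent : ∀ v → count (nonAdjacent v) ≡ 3
  count-nonAdjacent v = +-cancelˡ-≡ (n ∸ 3) _ _ (begin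
    n ∸ 3 + count (nonAdjacent v)   ≡⟨ cong (_+ count (nonAdjacent v)) (regular v) ⟨
    count (G v) + count (not ∘ G v) ≡⟨ count+count-not (G v) ⟩
    n                               ≡⟨ m∸n+n≡m 3≤n ⟨
    n ∸ 3 + 3                       ∎)
    where open ≡-Reasoning

  adjacent⇒≢ : ∀ {a b c} → G a b ≡ false → G a c ≡ true → c ≢ b
  adjacent⇒≢ Gab Gac refl = contradiction (trans (sym Gac) Gab) λ ()

  count-nonAdjacent∖self : ∀ v → count (nonAdjacent v ∖ v) ≡ 2
  count-nonAdjacent∖self v =
    suc-injective (trans (sym (count-∖ (nonAdjacent v) (cong not (G-irrefl v)))) (count-nonAdjacent v))

  count-nonAdjacent∖self∖other : ∀ {v c} → c ≢ v → G v c ≡ false → count ((nonAdjacent v ∖ v) ∖ c) ≡ 1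
  count-nonAdjacent∖self∖other {v} {c} c≢v Gvc =
    suc-injective (trans (sym (count-∖ (nonAdjacent v ∖ v) (trans (∖-≢ (nonAdjacent v) c≢v) (cong not Gvc))))
                         (count-nonAdjacent∖self v))

  nonNeighbour : ∀ v → ∃ λ c → c ≢ v × G v c ≡ false
  nonNeighbour v with count≡suc⇒∃ (nonAdjacent v ∖ v) (count-nonAdjacent∖self v)
  ... | c , c∈ with ∖-true (nonAdjacent v) c∈
  ...   | c≢v , ¬Gvc = c , c≢v , not-injective ¬Gvc

  anotherNonNeighbour : ∀ {v c} → c ≢ v → G v c ≡ false → ∃ λ d → d ≢ v × d ≢ c × G v d ≡ false
  anotherNonNeighbour {v} {c} c≢v Gvc
    with count≡suc⇒∃ ((nonAdjacent v ∖ v) ∖ c) (count-nonAdjacent∖self∖other c≢v Gvc)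
  ... | d , d∈ with ∖-true (nonAdjacent v ∖ v) d∈
  ...   | d≢c , d∈′ with ∖-true (nonAdjacent v) d∈′
  ...     | d≢v , ¬Gvd = d , d≢v , d≢c , not-injective ¬Gvd

  adjacent-to-rest : ∀ {a b c u} → b ≢ a → c ≢ a → c ≢ b → G a b ≡ false → G a c ≡ false →
                     u ≢ a → u ≢ b → u ≢ c → G a u ≡ true
  adjacent-to-rest {a} {b} {c} {u} b≢a c≢a c≢b Gab Gac u≢a u≢b u≢c = not-injective (begin
    not (G a u)                              ≡⟨ ∖-≢ (nonAdjacent a) u≢a ⟨
    (nonAdjacent a ∖ a) u                    ≡⟨ ∖-≢ (nonAdjacent a ∖ a) u≢b ⟨
    ((nonAdjacent a ∖ a) ∖ b) u              ≡⟨ ∖-≢ ((nonAdjacent a ∖ a) ∖ b) u≢c ⟨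
    (((nonAdjacent a ∖ a) ∖ b) ∖ c) u        ≡⟨ count≡0⇒false nothing-left u ⟩
    false                                    ∎)
    where
    open ≡-Reasoning
    nothing-left : count (((nonAdjacent a ∖ a) ∖ b) ∖ c) ≡ 0
    nothing-left = suc-injective (trans
      (sym (count-∖ ((nonAdjacent a ∖ a) ∖ b) (trans (∖-≢ (nonAdjacent a ∖ a) c≢b)
                                                (trans (∖-≢ (nonAdjacent a) c≢a) (cong not Gac)))))
      (count-nonAdjacent∖self∖other b≢a Gab))

  rdf-weight≥4 : ∀ f → IsRDF G f → 4 ≤ weight f
  rdf-weight≥4 f isRDF with any? (λ v → toℕ (f v) ≟ℕ 2)
  ... | no ∄two = begin
    4                  ≤⟨ ≤-trans (s≤s (s≤s (s≤s (s≤s z≤n)))) 6≤n ⟩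
    n                  ≡⟨ sum-ones n ⟨
    ∑[ v < n ] 1       ≤⟨ sum-mono-≤ positive ⟩
    sum (toℕ ∘ f)      ≡⟨ weight≡∑ f ⟨
    weight f           ∎
    where
    open ≤-Reasoning
    positive : ∀ u → 1 ≤ toℕ (f u)
    positive u = [ id , (λ { (v , _ , fv≡2) → contradiction (v , fv≡2) ∄two }) ]′ (rdf-positive⊎dominated isRDF u)
  ... | yes (v , fv≡2) with nonNeighbour v
  ...   | c , c≢v , Gvc with anotherNonNeighbour c≢v Gvc
  ...     | d , d≢v , d≢c , Gvd with rdf-positive⊎dominated isRDF c | rdf-positive⊎dominated isRDF d
  ...       | inj₂ (u , Gcu , fu≡2) | _ = two-twos≤weight f (adjacent⇒≢ (trans (G-sym c v) Gvc) Gcu) fv≡2 fu≡2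
  ...       | inj₁ _ | inj₂ (u , Gdu , fu≡2) = two-twos≤weight f (adjacent⇒≢ (trans (G-sym d v) Gvd) Gdu) fv≡2 fu≡2
  ...       | inj₁ 1≤fc | inj₁ 1≤fd = ≤-trans (+-mono-≤ (+-mono-≤ (≤-reflexive (sym fv≡2)) 1≤fc) 1≤fd)
                                        (≤-trans (triple≤sum (toℕ ∘ f) c≢v d≢v d≢c) (≤-reflexive (sym (weight≡∑ f))))

  record Independent₃ (a b c : Fin n) : Set where
    field
      b≢a : b ≢ a
      c≢a : c ≢ a
      c≢b : c ≢ b
      Gab : G a b ≡ false
      Gac : G a c ≡ false
      Gbc : G b c ≡ false

    adjacent-outside : ∀ {u} → u ≢ a → u ≢ b → u ≢ c → G a u ≡ true
    adjacent-outside = adjacent-to-rest b≢a c≢a c≢b Gab Gac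

  rotate : ∀ {a b c} → Independent₃ a b c → Independent₃ b c a
  rotate {a} {b} {c} t = record { b≢a = c≢b ; c≢a = ≢-sym b≢a ; c≢b = ≢-sym c≢a
                                ; Gab = Gbc ; Gac = trans (G-sym b a) Gab ; Gbc = trans (G-sym c a) Gac }
    where open Independent₃ t

  swap : ∀ {a b c} → Independent₃ a b c → Independent₃ b a c
  swap {a} {b} t = record { b≢a = ≢-sym b≢a ; c≢a = c≢b ; c≢b = c≢a
                          ; Gab = trans (G-sym b a) Gab ; Gac = Gbc ; Gbc = Gac }
    where open Independent₃ t

K333-nonadjacent-trans : ∀ {n} {G : Rel₂ n} → IsK333 G →
                         ∀ {a u v} → G a u ≡ false → G a v ≡ false → G u v ≡ false
K333-nonadjacent-trans {G = G} (_ , part , _ , classes) {a} {u} {v} Gau Gav with G u v in Guv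
... | false = refl
... | true  = contradiction (trans (sym (same-part Gau)) (same-part Gav)) (proj₁ (classes u v) Guv)
  where
  same-part : ∀ {w} → G a w ≡ false → part a ≡ part w
  same-part {w} Gaw with part a ≟ part w
  ... | yes eq  = eq
  ... | no  neq = contradiction (trans (sym (proj₂ (classes a w) neq)) Gaw) λ ()

module Bondage {n} {G B : Rel₂ n} (simple : IsSimpleGraph G) (6≤n : 6 ≤ n) (regular : Regular G (n ∸ 3))
               (bondage : IsRomanBondageSet G B) where

  open IsSimpleGraph simple renaming (irrefl to G-irrefl; sym to G-sym)
  open ComplementTwoRegular simple 6≤n regular public

  B-sym : ∀ i j → B i j ≡ B j i
  B-sym = proj₁ (proj₁ bondage)

  B⊆G : ∀ {u v} → B u v ≡ true → G u v ≡ true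
  B⊆G {u} {v} = proj₂ (proj₁ bondage) u v

  B-nonEdge : ∀ {u v} → G u v ≡ false → B u v ≡ false
  B-nonEdge {u} {v} Guv with B u v in Buv
  ... | false = refl
  ... | true  = contradiction (trans (sym (B⊆G Buv)) Guv) λ ()

  remaining : ∀ {u v} → G u v ≡ true → B u v ≡ false → removeEdges G B u v ≡ true
  remaining Guv Buv rewrite Guv | Buv = refl

  rdf-weight>4 : ∀ f → IsRDF (removeEdges G B) f → 4 < weight f
  rdf-weight>4 f isRDF =
    let (_ , _ , ((f₀ , isRDF₀ , weight≡k) , _) , raised) = bondage
    in ≤-<-trans (subst (4 ≤_) weight≡k (rdf-weight≥4 f₀ isRDF₀)) (raised f isRDF)

  ¬dominatingPair : ∀ {p q} → q ≢ p →
    ¬ (∀ u → u ≢ p → u ≢ q → removeEdges G B u p ≡ true ⊎ removeEdges G B u q ≡ true)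
  ¬dominatingPair q≢p dominated = <-irrefl (sym (weight-twoTwo q≢p)) (rdf-weight>4 _ (twoTwo-isRDF dominated))

  ¬dominatingVertexExceptTwo : ∀ {p q r} → q ≢ p → r ≢ p → r ≢ q →
    ¬ (∀ u → u ≢ p → u ≢ q → u ≢ r → removeEdges G B u p ≡ true)
  ¬dominatingVertexExceptTwo q≢p r≢p r≢q dominated =
    <-irrefl (sym (weight-twoOneOne q≢p r≢p r≢q)) (rdf-weight>4 _ (twoOneOne-isRDF dominated))

  every-vertex-meets-B : ∀ a → 1 ≤ count (B a)
  every-vertex-meets-B a with count (B a) in degree
  ... | suc _ = s≤s z≤n
  ... | zero with nonNeighbour a
  ...   | c , c≢a , Gac with anotherNonNeighbour c≢a Gac
  ...     | d , d≢a , d≢c , Gad = contradiction dominated (¬dominatingVertexExceptTwo c≢a d≢a d≢c)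
    where
    dominated : ∀ u → u ≢ a → u ≢ c → u ≢ d → removeEdges G B u a ≡ true
    dominated u u≢a u≢c u≢d = remaining (trans (G-sym u a) (adjacent-to-rest c≢a d≢a d≢c Gac Gad u≢a u≢c u≢d))
                                        (trans (B-sym u a) (count≡0⇒false degree u))

  partner-shared : ∀ {p q r p′} → Independent₃ p q r → count (B p) ≡ 1 → B p p′ ≡ true →
                   B q p′ ≡ true ⊎ B r p′ ≡ true
  partner-shared {p} {q} {r} {p′} t single Bpp′ with B q p′ in Bqp′ | B r p′ in Brp′
  ... | true  | _     = inj₁ refl
  ... | false | true  = inj₂ refl
  ... | false | false = contradiction dominated (¬dominatingPair p′≢p)
    where
    open Independent₃ t
    Gpp′ : G p p′ ≡ true
    Gpp′ = B⊆G Bpp′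
    p′≢p : p′ ≢ p
    p′≢p = adjacent⇒≢ (G-irrefl p) Gpp′
    p′≢q : p′ ≢ q
    p′≢q = adjacent⇒≢ Gab Gpp′
    p′≢r : p′ ≢ r
    p′≢r = adjacent⇒≢ Gac Gpp′
    dominated : ∀ u → u ≢ p → u ≢ p′ → removeEdges G B u p ≡ true ⊎ removeEdges G B u p′ ≡ true
    dominated u u≢p u≢p′ with u ≟ q | u ≟ r
    ... | yes refl | _        = inj₂ (remaining (Independent₃.adjacent-outside (swap t) p′≢q p′≢p p′≢r) Bqp′)
    ... | no _     | yes refl = inj₂ (remaining (Independent₃.adjacent-outside (rotate (rotate t)) p′≢r p′≢p p′≢q) Brp′)
    ... | no u≢q   | no u≢r   = inj₁ (remaining (trans (G-sym u p) (adjacent-outside u≢p u≢q u≢r))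
                                              (trans (B-sym u p) (count≡1-only (B p) single Bpp′ u≢p′)))

  common-partner : ∀ {x y z} → Independent₃ x y z → count (B x) ≡ 1 → count (B y) ≡ 1 → count (B z) ≡ 1 →
                   ∃ λ w → B x w ≡ true × B y w ≡ true × B z w ≡ true
  common-partner {x} {y} {z} t single-x single-y single-z with count≡suc⇒∃ (B x) single-x
  ... | w , Bxw with partner-shared t single-x Bxw
  ...   | inj₁ Byw with count≡suc⇒∃ (B z) single-z
  ...     | z′ , Bzz′ = w , Bxw , Byw , subst (λ v → B z v ≡ true) z′≡w Bzz′
    where
    z′≡w : z′ ≡ w
    z′≡w = [ count≡1-unique (B x) single-x Bxw , count≡1-unique (B y) single-y Byw ]′
             (partner-shared (rotate (rotate t)) single-z Bzz′)
  common-partner {x} {y} {z} t single-x single-y single-z | w , Bxw | inj₂ Bzw with count≡suc⇒∃ (B y) single-y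
  ...     | y′ , Byy′ = w , Bxw , subst (λ v → B y v ≡ true) y′≡w Byy′ , Bzw
    where
    y′≡w : y′ ≡ w
    y′≡w = [ count≡1-unique (B x) single-x Bxw , count≡1-unique (B z) single-z Bzw ]′
             (partner-shared (swap t) single-y Byy′)

  common-partner-saturated : ∀ {x y z w} → Independent₃ x y z → count (B x) ≡ 1 → count (B y) ≡ 1 → count (B z) ≡ 1 →
                  B x w ≡ true → B y w ≡ true → B z w ≡ true → ∀ u → B w u ≡ G w u
  common-partner-saturated {x} {y} {z} {w} t single-x single-y single-z Bxw Byw Bzw u with G w u in Gwu
  ... | false = B-nonEdge Gwu
  ... | true with u ≟ x | u ≟ y | u ≟ z
  ...   | yes refl | _        | _        = trans (B-sym w u) Bxw
  ...   | no _     | yes refl | _        = trans (B-sym w u) Byw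
  ...   | no _     | no _     | yes refl = trans (B-sym w u) Bzw
  ...   | no u≢x   | no u≢y   | no u≢z with B w u in Bwu
  ...     | true  = refl
  ...     | false = contradiction dominated (¬dominatingPair u≢x)
    where
    open Independent₃ t
    u≢w : u ≢ w
    u≢w = adjacent⇒≢ (G-irrefl w) Gwu
    dominated : ∀ v → v ≢ x → v ≢ u → removeEdges G B v x ≡ true ⊎ removeEdges G B v u ≡ true
    dominated v v≢x v≢u with v ≟ y | v ≟ z | v ≟ w
    ... | yes refl | _        | _        = inj₂ (remaining (Independent₃.adjacent-outside (swap t) u≢y u≢x u≢z)
                                                          (count≡1-only (B y) single-y Byw u≢w))
    ... | no _     | yes refl | _        = inj₂ (remaining (Independent₃.adjacent-outside (rotate (rotate t)) u≢z u≢x u≢y)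
                                                          (count≡1-only (B z) single-z Bzw u≢w))
    ... | no _     | no _     | yes refl = inj₂ (remaining Gwu Bwu)
    ... | no v≢y   | no v≢z   | no v≢w   = inj₁ (remaining (trans (G-sym v x) (adjacent-outside v≢x v≢y v≢z))
                                                          (trans (B-sym v x) (count≡1-only (B x) single-x Bxw v≢w)))

  independent-degree-sum≤|B| : (S : Fin n → Bool) → (∀ u v → S u ≡ true → S v ≡ true → G u v ≡ false) →
                               ∑[ v < n ] (count (B v) * 𝟙 (S v)) ≤ edgeCount B
  independent-degree-sum≤|B| S independent =
    independent-degree-sum≤edgeCount B-sym (λ i → B-nonEdge (G-irrefl i)) S
      (λ u v Su Sv → B-nonEdge (independent u v Su Sv))

  degree≡degree*𝟙 : ∀ (S : Fin n → Bool) {v} → S v ≡ true → count (B v) ≡ count (B v) * 𝟙 (S v)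
  degree≡degree*𝟙 S Sv rewrite Sv = sym (*-identityʳ _)

  nonadjacent-degree-sum≤|B| : ∀ {a b} → b ≢ a → G a b ≡ false → count (B a) + count (B b) ≤ edgeCount B
  nonadjacent-degree-sum≤|B| {a} {b} b≢a Gab = begin
    count (B a) + count (B b)                               ≡⟨ cong₂ _+_ (degree≡degree*𝟙 S Sa) (degree≡degree*𝟙 S Sb) ⟩
    count (B a) * 𝟙 (S a) + count (B b) * 𝟙 (S b)           ≤⟨ pair≤sum (λ v → count (B v) * 𝟙 (S v)) b≢a ⟩
    ∑[ v < n ] (count (B v) * 𝟙 (S v))                       ≤⟨ independent-degree-sum≤|B| S independent ⟩
    edgeCount B                                             ∎
    where
    open ≤-Reasoning
    S : Fin n → Bool
    S v = does (v ≟ a) ∨ does (v ≟ b)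
    Sa : S a ≡ true
    Sa rewrite dec-true (a ≟ a) refl = refl
    Sb : S b ≡ true
    Sb rewrite dec-false (b ≟ a) b≢a | dec-true (b ≟ b) refl = refl
    decode : ∀ u → S u ≡ true → u ≡ a ⊎ u ≡ b
    decode u Su with u ≟ a | u ≟ b
    decode u Su  | yes u≡a | _       = inj₁ u≡a
    decode u Su  | no _    | yes u≡b = inj₂ u≡b
    decode u ()  | no _    | no _
    independent : ∀ u v → S u ≡ true → S v ≡ true → G u v ≡ false
    independent u v Su Sv with decode u Su | decode v Sv
    ... | inj₁ refl | inj₁ refl = G-irrefl a
    ... | inj₁ refl | inj₂ refl = Gab
    ... | inj₂ refl | inj₁ refl = trans (G-sym b a) Gab
    ... | inj₂ refl | inj₂ refl = G-irrefl b

  K333-degree-sum≤|B| : IsK333 G → ∀ {a b c} → b ≢ a → c ≢ a → c ≢ b → G a b ≡ false → G a c ≡ false →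
                        count (B a) + count (B b) + count (B c) ≤ edgeCount B
  K333-degree-sum≤|B| K333 {a} {b} {c} b≢a c≢a c≢b Gab Gac = begin
    count (B a) + count (B b) + count (B c)
      ≡⟨ cong₂ _+_ (cong₂ _+_ (degree≡degree*𝟙 S Sa) (degree≡degree*𝟙 S (cong not Gab)))
                   (degree≡degree*𝟙 S (cong not Gac)) ⟩
    count (B a) * 𝟙 (S a) + count (B b) * 𝟙 (S b) + count (B c) * 𝟙 (S c)
      ≤⟨ triple≤sum (λ v → count (B v) * 𝟙 (S v)) b≢a c≢a c≢b ⟩
    ∑[ v < n ] (count (B v) * 𝟙 (S v))
      ≤⟨ independent-degree-sum≤|B| S (λ u v Su Sv → K333-nonadjacent-trans K333 (not-injective Su) (not-injective Sv)) ⟩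
    edgeCount B ∎
    where
    open ≤-Reasoning
    S : Fin n → Bool
    S = nonAdjacent a
    Sa : S a ≡ true
    Sa = cong not (G-irrefl a)

  saturated-vertex : ∀ {x y z} → Independent₃ x y z → count (B x) ≡ 1 → count (B y) ≡ 1 → count (B z) ≡ 1 →
                     ∃ λ w → count (B w) ≡ n ∸ 3
  saturated-vertex t single-x single-y single-z with common-partner t single-x single-y single-z
  ... | w , Bxw , Byw , Bzw =
    w , trans (count-cong (common-partner-saturated t single-x single-y single-z Bxw Byw Bzw)) (regular w)

  saturated⇒size-bounds : ∀ {w} → count (B w) ≡ n ∸ 3 → (n ∸ 2 ≤ edgeCount B) × (IsK333 G → n ∸ 1 ≤ edgeCount B)
  saturated⇒size-bounds {w} degree-w = n∸2≤|B| , n∸1≤|B|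
    where
    open ≤-Reasoning

    n∸2≤|B| : n ∸ 2 ≤ edgeCount B
    n∸2≤|B| with nonNeighbour w
    ... | a , a≢w , Gwa = begin
      n ∸ 2                      ≡⟨ m∸n≡suc[m∸suc[n]] 3≤n ⟩
      suc (n ∸ 3)                ≡⟨ +-comm 1 (n ∸ 3) ⟩
      n ∸ 3 + 1                  ≤⟨ +-mono-≤ (≤-reflexive (sym degree-w)) (every-vertex-meets-B a) ⟩
      count (B w) + count (B a)  ≤⟨ nonadjacent-degree-sum≤|B| a≢w Gwa ⟩
      edgeCount B                ∎

    n∸1≤|B| : IsK333 G → n ∸ 1 ≤ edgeCount B
    n∸1≤|B| K333 with nonNeighbour w
    ... | a , a≢w , Gwa with anotherNonNeighbour a≢w Gwa
    ... | b , b≢w , b≢a , Gwb = begin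
      n ∸ 1                                    ≡⟨ m∸n≡suc[m∸suc[n]] (≤-trans (s≤s (s≤s z≤n)) 3≤n) ⟩
      suc (n ∸ 2)                              ≡⟨ cong suc (m∸n≡suc[m∸suc[n]] 3≤n) ⟩
      2 + (n ∸ 3)                              ≡⟨ +-comm 2 (n ∸ 3) ⟩
      n ∸ 3 + 2                                ≡⟨ +-assoc (n ∸ 3) 1 1 ⟨
      n ∸ 3 + 1 + 1                            ≤⟨ +-mono-≤ (+-mono-≤ (≤-reflexive (sym degree-w)) (every-vertex-meets-B a))
                                                           (every-vertex-meets-B b) ⟩
      count (B w) + count (B a) + count (B b)  ≤⟨ K333-degree-sum≤|B| K333 a≢w b≢w b≢a Gwa Gwb ⟩
      edgeCount B                              ∎

lemma2p7 : (n : ℕ) (G : Rel₂ n) → IsSimpleGraph G → 6 ≤ n → Regular G (n ∸ 3) →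
    (B : Rel₂ n) → IsRomanBondageSet G B →
    (x y z : Fin n) → x ≢ y → y ≢ z → x ≢ z →
    G x y ≡ false → G y z ≡ false → G x z ≡ false →
    edgesAtIn B x ≡ 1 → edgesAtIn B y ≡ 1 → edgesAtIn B z ≡ 1 →
    (n ∸ 2 ≤ edgeCount B) × (IsK333 G → n ∸ 1 ≤ edgeCount B)
lemma2p7 n G simple 6≤n regular B bondage x y z x≢y y≢z x≢z Gxy Gyz Gxz single-x single-y single-z =
  saturated⇒size-bounds (proj₂ (saturated-vertex xyz single-x single-y single-z))
  where
  open Bondage simple 6≤n regular bondage
  xyz : Independent₃ x y z
  xyz = record { b≢a = ≢-sym x≢y ; c≢a = ≢-sym x≢z ; c≢b = ≢-sym y≢z ; Gab = Gxy ; Gac = Gxz ; Gbc = Gyz }
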